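{- Every strong P$^+$-filter on $\omega$ is a completely meager P$^+$-filter.
   Context: A filter on $\omega$ is a family of subsets of $\omega$ closed under finite intersections and supersets and containing all cofinite sets. $\mathcal F^+=\{X\subseteq\omega:\omega\setminus X\notin\mathcal F\}$; $A\subseteq^*B$ means $A\setminus B$ is finite; a natural number $m$ is identified with $\{0,\dots,m-1\}$. Subsets of $\omega$ are identified with characteristic functions in $2^\omega$ (product topology), and "meager" refers to this topology. $\mathcal F$ is a strong P$^+$-filter if for every sequence $\langle X_n\rangle$ from $\mathcal F^+$ there is $f\in{}^\omega\omega$ such that for every $X\in\mathcal F$, $X\cap X_n\cap f(n)\neq\emptyset$ for all but finitely many $n$. $\mathcal F$ is completely meager if the filter generated by $\mathcal F\cup\{X\}$ is meager whenever $X\in\mathcal F^+$. $\mathcal F$ is a P$^+$-filter if for every sequence $X_0\supseteq^*X_1\supseteq^*\cdots$ from $\mathcal F^+$ there is $X\in\mathcal F^+$ with $X\subseteq^*X_n$ for all $n$. -}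

module Defs where

open import Data.Nat using (ℕ; zero; suc; _≤_; _<_)
open import Data.Bool using (Bool; true; false; _∧_; not)
open import Data.List using (List; []; _∷_; _++_)
open import Data.List.Relation.Unary.All using (All)
open import Data.Product using (Σ; ∃; _×_; _,_)
open import Data.Sum using (_⊎_)
open import Data.Unit using (⊤)
open import Relation.Nullary using (¬_; Dec)
open import Relation.Binary.PropositionalEquality using (_≡_)

-- Excluded middle (the paper works in classical ZFC).
LEM : Set₁
LEM = (P : Set) → Dec P

-- Subsets of ω, identified with their characteristic functions in 2^ω.
Subset : Set
Subset = ℕ → Bool

_∈_ : ℕ → Subset → Set
n ∈ X = X n ≡ true

_⊆_ : Subset → Subset → Set
X ⊆ Y = ∀ n → n ∈ X → n ∈ Y

_∩_ : Subset → Subset → Subset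
(X ∩ Y) n = X n ∧ Y n

full : Subset
full _ = true

∁ : Subset → Subset
∁ X n = not (X n)

_⊆*_ : Subset → Subset → Set
A ⊆* B = ∃ λ m → ∀ n → m ≤ n → n ∈ A → n ∈ B

Cofinite : Subset → Set
Cofinite X = ∃ λ m → ∀ n → m ≤ n → n ∈ X

Family : Set₁
Family = Subset → Set

record IsFilter (F : Family) : Set₁ where
  field
    cofinite : ∀ X → Cofinite X → F X
    inter    : ∀ X Y → F X → F Y → F (X ∩ Y)
    superset : ∀ X Y → F X → X ⊆ Y → F Y

Plus : Family → Family
Plus F X = ¬ F (∁ X)

⋂ : List Subset → Subset
⋂ [] = full
⋂ (X ∷ Xs) = X ∩ ⋂ Xs

-- The filter generated by a family G: supersets of finite intersections of
-- members of G and cofinite sets (cofinite sets are closed under finite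
-- intersection, so a single cofinite set Cofinite C suffices).
Generated : Family → Family
Generated G Y =
  Σ Subset λ C → Σ (List Subset) λ Zs →
    Cofinite C × All G Zs × ((C ∩ ⋂ Zs) ⊆ Y)

-- F ∪ {X}  (membership of X up to pointwise equality)
_∪⟨_⟩ : Family → Subset → Family
(F ∪⟨ X ⟩) Y = F Y ⊎ (∀ n → Y n ≡ X n)

-- Topology of 2^ω: x lies in the basic open set [s] determined by the
-- finite binary string s.
Extends : List Bool → Subset → Set
Extends [] x = ⊤
Extends (b ∷ s) x = (x 0 ≡ b) × Extends s (λ n → x (suc n))

NowhereDense : Family → Set
NowhereDense N = ∀ (s : List Bool) → ∃ λ (t : List Bool) →
  ∀ x → Extends (s ++ t) x → ¬ N x

Meager : Family → Set₁
Meager M = Σ (ℕ → Family) λ N →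
  (∀ k → NowhereDense (N k)) × (∀ x → M x → ∃ λ k → N k x)

StrongPPlus : Family → Set
StrongPPlus F = ∀ (Xs : ℕ → Subset) → (∀ n → Plus F (Xs n)) →
  ∃ λ (f : ℕ → ℕ) → ∀ X → F X →
    ∃ λ m → ∀ n → m ≤ n → ∃ λ k → k < f n × k ∈ X × k ∈ Xs n

CompletelyMeager : Family → Set₁
CompletelyMeager F = ∀ X → Plus F X → Meager (Generated (F ∪⟨ X ⟩))

PPlus : Family → Set
PPlus F = ∀ (Xs : ℕ → Subset) → (∀ n → Plus F (Xs n)) →
  (∀ n → Xs (suc n) ⊆* Xs n) →
  ∃ λ X → Plus F X × (∀ n → X ⊆* Xs n)

-- Both properties come from applying strong P⁺-ness to a well-chosen sequence ⟨Yₙ⟩ of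
-- positive sets, which yields f with Z ∩ Yₙ ∩ f n ≠ ∅ for every Z ∈ F and almost all n.
--
-- P⁺: for a ⊆*-descending ⟨Xₙ⟩, take Yₙ = [n,∞) ∩ X₀ ∩ ⋯ ∩ Xₙ (still positive,
-- since Xₙ ⊆* Yₙ) and take the diagonal union ⋃ₘ (Yₘ ∩ f m). It meets every member of F,
-- hence is positive, and beyond max_{m<n} f m it only contains points of Yₘ with m ≥ n,
-- which lie in Xₙ.
--
-- Complete meagerness: with Yₙ = [n,∞) ∩ X, every set generated by F ∪ {X} contains Z ∩ X
-- up to a finite set for some Z ∈ F, so it meets the interval [n, f n) for almost all n.
-- For each k the sets meeting all [n, f n) with n ≥ k form a nowhere dense family: extend
-- any finite string by zeros up to f n with n past its length.
module Submission where

open import Defs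
open import Data.Bool using (Bool; true; false; _∧_; not)
open import Data.Bool.Properties using () renaming (_≟_ to _≟ᵇ_)
open import Data.List using ([]; _∷_; _++_; length; replicate)
open import Data.List.Relation.Unary.All using (All; []; _∷_)
open import Data.Nat using (ℕ; zero; suc; _+_; _∸_; _⊔_; _≤_; _<_; _≤′_; ≤′-refl; ≤′-step; _≤?_; _<?_; s≤s)
open import Data.Nat.Properties
  using (≤-refl; ≤-trans; ≤-<-trans; <⇒≱; ≰⇒>; ≤⇒≤′; m≤m⊔n; m≤n⊔m; m⊔n≤o⇒m≤o; m⊔n≤o⇒n≤o; m∸n≤m; m+[n∸m]≡n; anyUpTo?)
open import Data.Product using (∃; _×_; _,_; proj₁; proj₂)
open import Data.Sum using (inj₁; inj₂)
open import Data.Empty using (⊥-elim)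
open import Function using (_∘_; case_of_)
open import Relation.Nullary using (¬_; yes; no; does)
open import Relation.Nullary.Decidable using (dec-true; _×-dec_)
open import Relation.Unary using (Decidable)
open import Relation.Binary.PropositionalEquality using (_≡_; refl; sym; trans; cong; module ≡-Reasoning)

private variable
  A B C X Y : Subset
  F : Family
  Xs : ℕ → Subset
  k m n : ℕ
  a b : Bool

⟦_⟧ : {P : ℕ → Set} → Decidable P → Subset
⟦ P? ⟧ n = does (P? n)

∈⟦⟧⁺ : {P : ℕ → Set} (P? : Decidable P) → P n → n ∈ ⟦ P? ⟧
∈⟦⟧⁺ P? = dec-true (P? _)

∈⟦⟧⁻ : {P : ℕ → Set} (P? : Decidable P) → n ∈ ⟦ P? ⟧ → P n
∈⟦⟧⁻ {n = n} P? n∈⟦P?⟧ with P? n | n∈⟦P?⟧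
... | yes p | _  = p
... | no _  | ()

∧-true⁺ : a ≡ true → b ≡ true → a ∧ b ≡ true
∧-true⁺ refl refl = refl

∧-true⁻ : a ∧ b ≡ true → a ≡ true × b ≡ true
∧-true⁻ {true} b≡true = refl , b≡true

not-true⁺ : ¬ a ≡ true → not a ≡ true
not-true⁺ {true}  a≢true = ⊥-elim (a≢true refl)
not-true⁺ {false} _      = refl

not-true⁻ : not a ≡ true → ¬ a ≡ true
not-true⁻ {false} _ ()

atLeast : ℕ → Subset
atLeast n = ⟦ n ≤?_ ⟧

⊆*-refl : A ⊆* A
⊆*-refl = 0 , λ _ _ n∈A → n∈A

⊆*-trans : A ⊆* B → B ⊆* C → A ⊆* C
⊆*-trans (a , A⊆*B) (b , B⊆*C) =
  a ⊔ b , λ n a⊔b≤n → B⊆*C n (m⊔n≤o⇒n≤o a b a⊔b≤n) ∘ A⊆*B n (m⊔n≤o⇒m≤o a b a⊔b≤n)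

⊆*-∩ : A ⊆* B → A ⊆* C → A ⊆* (B ∩ C)
⊆*-∩ (b , A⊆*B) (c , A⊆*C) =
  b ⊔ c , λ n b⊔c≤n n∈A →
    ∧-true⁺ (A⊆*B n (m⊔n≤o⇒m≤o b c b⊔c≤n) n∈A) (A⊆*C n (m⊔n≤o⇒n≤o b c b⊔c≤n) n∈A)

∈-atLeast⁻ : n ∈ atLeast m → m ≤ n
∈-atLeast⁻ {m = m} = ∈⟦⟧⁻ (m ≤?_)

atLeast-cofinite : ∀ m → Cofinite (atLeast m)
atLeast-cofinite m = m , λ _ → ∈⟦⟧⁺ (m ≤?_)

⊆*-atLeast : ∀ m → A ⊆* atLeast m
⊆*-atLeast m = m , λ n m≤n _ → proj₂ (atLeast-cofinite m) n m≤n

module _ (isF : IsFilter F) where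
  open IsFilter isF

  Plus-⊆* : Plus F A → A ⊆* B → Plus F B
  Plus-⊆* {A} {B} A⁺ (m , A⊆*B) ∁B∈F =
    A⁺ (superset _ _ (inter _ _ ∁B∈F (cofinite (atLeast m) (atLeast-cofinite m))) ∁B∩atLeast⊆∁A)
    where
    ∁B∩atLeast⊆∁A : (∁ B ∩ atLeast m) ⊆ ∁ A
    ∁B∩atLeast⊆∁A n n∈ =
      let n∈∁B , n∈atLeast = ∧-true⁻ n∈
      in not-true⁺ (not-true⁻ n∈∁B ∘ A⊆*B n (∈-atLeast⁻ n∈atLeast))

  ⋂-∪⟨⟩ : ∀ {Zs} → All (F ∪⟨ X ⟩) Zs → ∃ λ Z → F Z × (Z ∩ X) ⊆ ⋂ Zs
  ⋂-∪⟨⟩ [] = full , cofinite full (0 , λ _ _ → refl) , λ _ _ → refl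
  ⋂-∪⟨⟩ {X = X} {Zs = W ∷ _} (inj₁ W∈F ∷ Zs∈) with ⋂-∪⟨⟩ Zs∈
  ... | Z , Z∈F , Z∩X⊆⋂ = W ∩ Z , inter W Z W∈F Z∈F , W∩Z∩X⊆W∩⋂
    where
    W∩Z∩X⊆W∩⋂ : ((W ∩ Z) ∩ X) ⊆ (W ∩ _)
    W∩Z∩X⊆W∩⋂ n n∈W∩Z∩X with ∧-true⁻ n∈W∩Z∩X
    ... | n∈W∩Z , n∈X with ∧-true⁻ n∈W∩Z
    ... | n∈W , n∈Z = ∧-true⁺ n∈W (Z∩X⊆⋂ n (∧-true⁺ n∈Z n∈X))
  ⋂-∪⟨⟩ (inj₂ W≗X ∷ Zs∈) with ⋂-∪⟨⟩ Zs∈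
  ... | Z , Z∈F , Z∩X⊆⋂ =
    Z , Z∈F , λ n n∈Z∩X → ∧-true⁺ (trans (W≗X n) (proj₂ (∧-true⁻ n∈Z∩X))) (Z∩X⊆⋂ n n∈Z∩X)

  Generated-∪⟨⟩⁻ : Generated (F ∪⟨ X ⟩) Y → ∃ λ Z → F Z × (Z ∩ X) ⊆* Y
  Generated-∪⟨⟩⁻ (C , Zs , (c , C-cofinite) , Zs∈ , C∩⋂⊆Y) =
    let Z , Z∈F , Z∩X⊆⋂ = ⋂-∪⟨⟩ Zs∈
    in Z , Z∈F , c , λ n c≤n n∈Z∩X → C∩⋂⊆Y n (∧-true⁺ (C-cofinite n c≤n) (Z∩X⊆⋂ n n∈Z∩X))

Extends-++⁻ʳ : ∀ s {t x} → Extends (s ++ t) x → Extends t (λ j → x (length s + j))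
Extends-++⁻ʳ []      x∈[t]              = x∈[t]
Extends-++⁻ʳ (_ ∷ s) (_ , x∈[s++t]) = Extends-++⁻ʳ s x∈[s++t]

Extends-replicate⁻ : ∀ r {b x i} → Extends (replicate r b) x → i < r → x i ≡ b
Extends-replicate⁻ (suc r) {i = zero}  (x0≡b , _) _ = x0≡b
Extends-replicate⁻ (suc r) {i = suc i} (_ , x∈[bʳ]) (s≤s i<r) = Extends-replicate⁻ r x∈[bʳ] i<r

Extends-++-replicate⁻ : ∀ s {r b x i} → Extends (s ++ replicate r b) x → length s ≤ i → i < r → x i ≡ b
Extends-++-replicate⁻ s {r} {b} {x} {i} x∈[s++bʳ] |s|≤i i<r = begin
  x i                            ≡⟨ cong x (sym (m+[n∸m]≡n |s|≤i)) ⟩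
  x (length s + (i ∸ length s))  ≡⟨ Extends-replicate⁻ r (Extends-++⁻ʳ s x∈[s++bʳ]) i∸|s|<r ⟩
  b                              ∎
  where
  open ≡-Reasoning

  i∸|s|<r : i ∸ length s < r
  i∸|s|<r = ≤-<-trans (m∸n≤m i (length s)) i<r

HitsIntervalsFrom : (ℕ → ℕ) → ℕ → Family
HitsIntervalsFrom g k Z = ∀ n → k ≤ n → ∃ λ i → n ≤ i × i < g n × i ∈ Z

HitsIntervalsFrom-nowhereDense : ∀ g k → NowhereDense (HitsIntervalsFrom g k)
HitsIntervalsFrom-nowhereDense g k s = replicate (g n₀) false , misses
  where
  n₀ : ℕ
  n₀ = k ⊔ length s

  misses : ∀ x → Extends (s ++ replicate (g n₀) false) x → ¬ HitsIntervalsFrom g k x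
  misses x x∈[s0ᵍ⁽ⁿ⁰⁾] hits with hits n₀ (m≤m⊔n k (length s))
  ... | i , n₀≤i , i<gn₀ , i∈x =
    case trans (sym i∈x) (Extends-++-replicate⁻ s x∈[s0ᵍ⁽ⁿ⁰⁾] |s|≤i i<gn₀) of λ ()
    where
    |s|≤i : length s ≤ i
    |s|≤i = ≤-trans (m≤n⊔m k (length s)) n₀≤i

prefix∩ : (ℕ → Subset) → ℕ → Subset
prefix∩ Xs zero    = Xs zero
prefix∩ Xs (suc n) = Xs (suc n) ∩ prefix∩ Xs n

prefix∩-⊆-last : ∀ n → prefix∩ Xs n ⊆ Xs n
prefix∩-⊆-last zero    _ i∈X₀      = i∈X₀
prefix∩-⊆-last (suc n) _ i∈prefix = proj₁ (∧-true⁻ i∈prefix)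

prefix∩-⊆ : m ≤′ n → prefix∩ Xs n ⊆ Xs m
prefix∩-⊆ {m} ≤′-refl   = prefix∩-⊆-last m
prefix∩-⊆ (≤′-step m≤n) i i∈prefix = prefix∩-⊆ m≤n i (proj₂ (∧-true⁻ i∈prefix))

descending⇒⊆*-prefix∩ : (∀ n → Xs (suc n) ⊆* Xs n) → ∀ n → Xs n ⊆* prefix∩ Xs n
descending⇒⊆*-prefix∩ descending zero    = ⊆*-refl
descending⇒⊆*-prefix∩ descending (suc n) =
  ⊆*-∩ ⊆*-refl (⊆*-trans (descending n) (descending⇒⊆*-prefix∩ descending n))

maxBelow : (ℕ → ℕ) → ℕ → ℕ
maxBelow f zero    = 0
maxBelow f (suc n) = f n ⊔ maxBelow f n

<⇒≤maxBelow : ∀ f → m < n → f m ≤ maxBelow f n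
<⇒≤maxBelow f = go ∘ ≤⇒≤′
  where
  go : suc m ≤′ n → f m ≤ maxBelow f n
  go ≤′-refl       = m≤m⊔n _ _
  go (≤′-step m<n) = ≤-trans (go m<n) (m≤n⊔m _ _)

-- k lies in ⋃ₘ (Yₘ ∩ f m), searching only m ≤ k; this loses nothing when Yₘ ⊆ [m,∞).
InDiagonal : (ℕ → Subset) → (ℕ → ℕ) → ℕ → Set
InDiagonal Ys f k = ∃ λ m → m < suc k × k < f m × k ∈ Ys m

inDiagonal? : ∀ Ys f → Decidable (InDiagonal Ys f)
inDiagonal? Ys f k = anyUpTo? (λ m → k <? f m ×-dec Ys m k ≟ᵇ true) (suc k)

diagonal : (ℕ → Subset) → (ℕ → ℕ) → Subset
diagonal Ys f = ⟦ inDiagonal? Ys f ⟧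

∈-diagonal⁺ : ∀ Ys f → m ≤ k → k < f m → k ∈ Ys m → k ∈ diagonal Ys f
∈-diagonal⁺ {m} Ys f m≤k k<fm k∈Yₘ = ∈⟦⟧⁺ (inDiagonal? Ys f) (m , s≤s m≤k , k<fm , k∈Yₘ)

∈-diagonal⁻ : ∀ Ys f → k ∈ diagonal Ys f → ∃ λ m → k < f m × k ∈ Ys m
∈-diagonal⁻ Ys f k∈diagonal =
  let m , _ , k<fm , k∈Yₘ = ∈⟦⟧⁻ (inDiagonal? Ys f) k∈diagonal in m , k<fm , k∈Yₘ

diagonal-⊆* : ∀ Ys f → (∀ m → n ≤ m → Ys m ⊆ A) → diagonal Ys f ⊆* A
diagonal-⊆* {n} Ys f Yₘ⊆A = maxBelow f n , λ k bound≤k k∈diagonal →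
  let m , k<fm , k∈Yₘ = ∈-diagonal⁻ Ys f k∈diagonal in
  case n ≤? m of λ where
    (yes n≤m) → Yₘ⊆A m n≤m k k∈Yₘ
    (no  n≰m) → ⊥-elim (<⇒≱ k<fm (≤-trans (<⇒≤maxBelow f (≰⇒> n≰m)) bound≤k))

module _ (isF : IsFilter F) (strong : StrongPPlus F) where

  strongPPlus⇒PPlus : PPlus F
  strongPPlus⇒PPlus Xs Xs⁺ descending = diagonal Ys f , diagonal⁺ , diagonal⊆*Xs
    where
    Ys : ℕ → Subset
    Ys n = atLeast n ∩ prefix∩ Xs n

    Ys⁺ : ∀ n → Plus F (Ys n)
    Ys⁺ n = Plus-⊆* isF (Xs⁺ n) (⊆*-∩ (⊆*-atLeast n) (descending⇒⊆*-prefix∩ descending n))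

    f : ℕ → ℕ
    f = proj₁ (strong Ys Ys⁺)

    diagonal⁺ : Plus F (diagonal Ys f)
    diagonal⁺ ∁diagonal∈F with proj₂ (strong Ys Ys⁺) _ ∁diagonal∈F
    ... | m , hits with hits m ≤-refl
    ... | k , k<fm , k∉diagonal , k∈Yₘ =
      not-true⁻ k∉diagonal (∈-diagonal⁺ Ys f (∈-atLeast⁻ (proj₁ (∧-true⁻ k∈Yₘ))) k<fm k∈Yₘ)

    diagonal⊆*Xs : ∀ n → diagonal Ys f ⊆* Xs n
    diagonal⊆*Xs n = diagonal-⊆* Ys f λ m n≤m k k∈Yₘ →
      prefix∩-⊆ (≤⇒≤′ n≤m) k (proj₂ (∧-true⁻ k∈Yₘ))

  strongPPlus⇒completelyMeager : CompletelyMeager F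
  strongPPlus⇒completelyMeager X X⁺ =
    HitsIntervalsFrom f , HitsIntervalsFrom-nowhereDense f , covered
    where
    tails : ℕ → Subset
    tails n = atLeast n ∩ X

    tails⁺ : ∀ n → Plus F (tails n)
    tails⁺ n = Plus-⊆* isF X⁺ (⊆*-∩ (⊆*-atLeast n) ⊆*-refl)

    f : ℕ → ℕ
    f = proj₁ (strong tails tails⁺)

    covered : ∀ Y → Generated (F ∪⟨ X ⟩) Y → ∃ λ k → HitsIntervalsFrom f k Y
    covered Y Y∈⟨F∪X⟩ with Generated-∪⟨⟩⁻ isF Y∈⟨F∪X⟩
    ... | Z , Z∈F , c , Z∩X⊆*Y with proj₂ (strong tails tails⁺) Z Z∈F
    ... | m , hits = m ⊔ c , hitsY
      where
      hitsY : HitsIntervalsFrom f (m ⊔ c) Y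
      hitsY n m⊔c≤n with hits n (m⊔n≤o⇒m≤o m c m⊔c≤n)
      ... | i , i<fn , i∈Z , i∈Xₙ with ∧-true⁻ i∈Xₙ
      ... | i∈atLeast , i∈X =
        i , n≤i , i<fn , Z∩X⊆*Y i (≤-trans (m⊔n≤o⇒n≤o m c m⊔c≤n) n≤i) (∧-true⁺ i∈Z i∈X)
        where
        n≤i : n ≤ i
        n≤i = ∈-atLeast⁻ i∈atLeast

mainTheorem7 : LEM → (F : Family) → IsFilter F → StrongPPlus F →
    CompletelyMeager F × PPlus F
mainTheorem7 _ F isF strong =
  strongPPlus⇒completelyMeager isF strong , strongPPlus⇒PPlus isF strong
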